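{- Let $\lambda$ be a nonzero real number. For all integers $n\geq 1$ and $k\in\mathbb{Z}$, \[ E_{n-1,\lambda}^{(k)}(1)+E_{n-1,\lambda}^{(k)}=\frac{2^{n}}{n}\sum_{l=1}^{n}\frac{(1)_{l,1/\lambda}(-1)^{n-1}\lambda^{l-1}}{l^{k-1}}\,S_{2,\lambda}(n,l). \]
   Context: For nonzero $\lambda$, $e_\lambda^x(t)=(1+\lambda t)^{x/\lambda}$ and $e_\lambda(t)=(1+\lambda t)^{1/\lambda}$; $(1)_{l,1/\lambda}=\prod_{i=0}^{l-1}(1-i/\lambda)$. The degenerate Stirling numbers of the second kind are defined by $\frac{1}{l!}(e_\lambda(t)-1)^l=\sum_{n=l}^{\infty}S_{2,\lambda}(n,l)\frac{t^n}{n!}$. The degenerate polylogarithm is $l_{k,\lambda}(x)=\sum_{n=1}^{\infty}\frac{(-\lambda)^{n-1}(1)_{n,1/\lambda}}{(n-1)!\,n^{k}}x^{n}$ for $k\in\mathbb{Z}$. The degenerate poly-Euler polynomials are defined by \[ \frac{l_{k,\lambda}\big(1-e_{\lambda}(-2t)\big)}{t(e_{\lambda}(t)+1)}e_{\lambda}^{x}(t)=\sum_{n=0}^{\infty}E_{n,\lambda}^{(k)}(x)\frac{t^{n}}{n!}, \] and $E_{n,\lambda}^{(k)}=E_{n,\lambda}^{(k)}(0)$. -}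

module Defs where

open import Level using (Level; _⊔_) renaming (suc to lsuc)
open import Data.Nat using (ℕ; zero; suc; _∸_; _≤?_; _!)
open import Data.Integer using (ℤ; +_; -[1+_])
open import Relation.Nullary using (¬_; yes; no)
open import Algebra.Bundles using (CommutativeRing)

natCast : ∀ {c ℓ} (R : CommutativeRing c ℓ) → ℕ → CommutativeRing.Carrier R
natCast R zero    = CommutativeRing.0# R
natCast R (suc n) = CommutativeRing._+_ R (CommutativeRing.1# R) (natCast R n)

-- A field of characteristic zero, presented as a commutative ring with a
-- total inversion map (value at 0 irrelevant) that inverts every nonzero
-- element, and in which 1 + 1 + ... + 1 (n+1 times) is never 0.
record Char0Field (c ℓ : Level) : Set (lsuc (c ⊔ ℓ)) where
  field
    commRing : CommutativeRing c ℓ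
  open CommutativeRing commRing public
  field
    _⁻¹      : Carrier → Carrier
    ⁻¹-cong  : ∀ {x y} → x ≈ y → x ⁻¹ ≈ y ⁻¹
    inverseʳ : ∀ x → ¬ (x ≈ 0#) → x * (x ⁻¹) ≈ 1#
    char0    : ∀ n → ¬ (natCast commRing (suc n) ≈ 0#)

  ι : ℕ → Carrier
  ι = natCast commRing

-- Formal power series are
-- coefficient functions ℕ → Carrier ([t^n] f = f n).
module Degenerate {c ℓ : Level} (F : Char0Field c ℓ) (lam : Char0Field.Carrier F) where
  open Char0Field F

  Series : Set c
  Series = ℕ → Carrier

  pow : Carrier → ℕ → Carrier
  pow x zero    = 1#
  pow x (suc n) = x * pow x n

  sumTo : ℕ → (ℕ → Carrier) → Carrier
  sumTo zero    f = 0#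
  sumTo (suc n) f = sumTo n f + f n

  -- generalized falling factorial (x)_{n,μ} = ∏_{i<n} (x - i μ)
  ff : Carrier → Carrier → ℕ → Carrier
  ff x μ zero    = 1#
  ff x μ (suc n) = ff x μ n * (x - ι n * μ)

  invPow : ℕ → ℤ → Carrier
  invPow m (+ n)    = (pow (ι m) n) ⁻¹
  invPow m -[1+ n ] = pow (ι m) (suc n)

  δ : Series
  δ zero    = 1#
  δ (suc n) = 0#

  mulS : Series → Series → Series
  mulS f g n = sumTo (suc n) (λ i → f i * g (n ∸ i))

  powS : Series → ℕ → Series
  powS f zero    = δ
  powS f (suc m) = mulS f (powS f m)

  -- composition a(u(t)) for u with zero constant term
  compS : Series → Series → Series
  compS a u n = sumTo (suc n) (λ m → a m * powS u m n)

  -- division by t (for a series with zero constant term)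
  shift : Series → Series
  shift f n = f (suc n)

  -- multiplicative inverse of a series with invertible constant term:
  -- b 0 = f0⁻¹ ,  b n = - f0⁻¹ Σ_{i=1}^{n} f i b (n-i)
  private
    invUpTo : Series → ℕ → Series
    invUpTo f zero    = λ _ → (f 0) ⁻¹
    invUpTo f (suc n) j with j ≤? n
    ... | yes _ = invUpTo f n j
    ... | no  _ = - ((f 0) ⁻¹ * sumTo (suc n) (λ i → f (suc i) * invUpTo f n (n ∸ i)))

  invS : Series → Series
  invS f n = invUpTo f n n

  -- e_λ^x(t) = (1+λt)^{x/λ} = Σ (x)_{n,λ} t^n / n!
  expλ : Carrier → Series
  expλ x n = ff x lam n * (ι (n !)) ⁻¹

  eλ : Series
  eλ = expλ 1#

  oneMinusEλm2 : Series
  oneMinusEλm2 n = δ n - eλ n * pow (- ι 2) n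

  -- coefficients of the degenerate polylogarithm l_{k,λ}(x)
  polylogCoef : ℤ → Series
  polylogCoef k zero    = 0#
  polylogCoef k (suc j) =
    pow (- lam) j * ff 1# (lam ⁻¹) (suc j) * (ι (j !)) ⁻¹ * invPow (suc j) k

  -- generating function  l_{k,λ}(1-e_λ(-2t)) / (t (e_λ(t)+1)) · e_λ^x(t)
  eulerGF : ℤ → Carrier → Series
  eulerGF k x =
    mulS (mulS (shift (compS (polylogCoef k) oneMinusEλm2))
               (invS (λ n → eλ n + δ n)))
         (expλ x)

  E : ℕ → ℤ → Carrier → Carrier
  E n k x = ι (n !) * eulerGF k x n

  S2 : ℕ → ℕ → Carrier
  S2 n l = ι (n !) * (ι (l !)) ⁻¹ * powS (λ m → eλ m - δ m) l n

{-# OPTIONS --safe #-}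
-- Adding the Euler polynomials at x = 1 and x = 0 multiplies their generating
-- function by e_λ(t) + 1, which cancels its denominator and leaves
-- l_{k,λ}(1 - e_λ(-2t)) / t. Since 1 - e_λ(-2t) = -(e_λ(u) - 1) at u = -2t and
-- [u^n] (e_λ(u) - 1)^l = l! S_{2,λ}(n,l) / n!, the coefficient of t^(n-1) is a
-- sum over l of the polylogarithm coefficients times (-1)^l (-2)^n l! S_{2,λ}(n,l) / n!,
-- which rearranges into the stated sum.
module Submission where

open import Defs
open import Level using (Level)
open import Data.Nat using (ℕ; suc; _∸_; _≤_)
open import Data.Integer using (ℤ) renaming (_-_ to _-ℤ_; +_ to ℤ+_)
open import Relation.Nullary using (¬_)
open import Data.Nat as ℕ using (zero; _<_; s≤s; _!)
import Data.Nat.Properties as ℕ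
open import Data.Nat.Properties
  using (m<n⇒m<1+n; n<1+n; n∸n≡0; +-∸-assoc; m+[n∸m]≡n; m∸[m∸n]≡n; m+n∸m≡n; ∸-+-assoc; n≮n; m∸n≤m; ≤-pred)
open import Data.Integer using (-[1+_])
open import Data.Product using (Σ-syntax; _,_; proj₁; proj₂)
open import Data.Empty using (⊥-elim)
open import Relation.Nullary using (yes; no)
open import Relation.Binary.PropositionalEquality as P using (_≡_)
import Algebra.Properties.CommutativeSemigroup as CommutativeSemigroupProperties
import Algebra.Properties.CommutativeSemiring.Exp as ExpProperties
import Algebra.Properties.Semiring.Mult as MultProperties
import Algebra.Properties.Ring as RingProperties
import Algebra.Properties.AbelianGroup as AbelianGroupProperties
import Algebra.Solver.CommutativeMonoid as CommutativeMonoidSolver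

module _ {c ℓ} (F : Char0Field c ℓ) (lam : Char0Field.Carrier F) where
  open Char0Field F
  open Degenerate F lam
  open import Relation.Binary.Reasoning.Setoid setoid
  open CommutativeSemigroupProperties +-commutativeSemigroup using () renaming (interchange to +-interchange)
  open CommutativeSemigroupProperties *-commutativeSemigroup using () renaming (interchange to *-interchange)
  open ExpProperties commutativeSemiring using (_^_; ^-congˡ; ^-homo-*; ^-distrib-*)
  open MultProperties semiring using (_×_; ×1-homo-*)
  open RingProperties ring using (-1*x≈-x; -‿distribʳ-*; x[y-z]≈xy-xz)
  open AbelianGroupProperties +-abelianGroup using (⁻¹-anti-homo‿-; ε⁻¹≈ε; ⁻¹-involutive)
  open CommutativeMonoidSolver *-commutativeMonoid using (solve; _⊜_; _⊕_)

  sumTo-cong-< : ∀ n {f g : ℕ → Carrier} → (∀ i → i < n → f i ≈ g i) → sumTo n f ≈ sumTo n g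
  sumTo-cong-< zero    f≈g = refl
  sumTo-cong-< (suc n) f≈g =
    +-cong (sumTo-cong-< n (λ i i<n → f≈g i (m<n⇒m<1+n i<n))) (f≈g n (n<1+n n))

  sumTo-cong : ∀ n {f g : ℕ → Carrier} → (∀ i → f i ≈ g i) → sumTo n f ≈ sumTo n g
  sumTo-cong n f≈g = sumTo-cong-< n (λ i _ → f≈g i)

  sumTo-cong-bound : ∀ {m n} (f : ℕ → Carrier) → m ≡ n → sumTo m f ≈ sumTo n f
  sumTo-cong-bound f m≡n = reflexive (P.cong (λ m → sumTo m f) m≡n)

  sumTo-zero : ∀ n → sumTo n (λ _ → 0#) ≈ 0#
  sumTo-zero zero    = refl
  sumTo-zero (suc n) = trans (+-identityʳ _) (sumTo-zero n)

  sumTo-distrib-+ : ∀ n (f g : ℕ → Carrier) → sumTo n (λ i → f i + g i) ≈ sumTo n f + sumTo n g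
  sumTo-distrib-+ zero    f g = sym (+-identityˡ 0#)
  sumTo-distrib-+ (suc n) f g =
    trans (+-cong (sumTo-distrib-+ n f g) refl) (+-interchange _ _ _ _)

  *-distribˡ-sumTo : ∀ n a (f : ℕ → Carrier) → a * sumTo n f ≈ sumTo n (λ i → a * f i)
  *-distribˡ-sumTo zero    a f = zeroʳ a
  *-distribˡ-sumTo (suc n) a f = trans (distribˡ a _ _) (+-cong (*-distribˡ-sumTo n a f) refl)

  *-distribʳ-sumTo : ∀ n a (f : ℕ → Carrier) → sumTo n f * a ≈ sumTo n (λ i → f i * a)
  *-distribʳ-sumTo n a f =
    trans (*-comm _ a) (trans (*-distribˡ-sumTo n a f) (sumTo-cong n (λ i → *-comm a (f i))))

  sumTo-head : ∀ n (f : ℕ → Carrier) → sumTo (suc n) f ≈ f 0 + sumTo n (λ i → f (suc i))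
  sumTo-head zero    f = trans (+-identityˡ _) (sym (+-identityʳ _))
  sumTo-head (suc n) f = trans (+-cong (sumTo-head n f) refl) (+-assoc _ _ _)

  sumTo-reverse : ∀ n (f : ℕ → Carrier) → sumTo (suc n) f ≈ sumTo (suc n) (λ i → f (n ∸ i))
  sumTo-reverse zero    f = refl
  sumTo-reverse (suc n) f = begin
    sumTo (suc n) f + f (suc n)                  ≈⟨ +-cong (sumTo-reverse n f) refl ⟩
    sumTo (suc n) (λ i → f (n ∸ i)) + f (suc n)  ≈⟨ +-comm _ _ ⟩
    f (suc n) + sumTo (suc n) (λ i → f (n ∸ i))  ≈⟨ sumTo-head (suc n) (λ i → f (suc n ∸ i)) ⟨
    sumTo (suc (suc n)) (λ i → f (suc n ∸ i))    ∎

  sumTo-triangle : ∀ N (G : ℕ → ℕ → Carrier) →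
    sumTo N (λ j → sumTo (suc j) (λ i → G i j)) ≈ sumTo N (λ i → sumTo (N ∸ i) (λ l → G i (i ℕ.+ l)))
  sumTo-triangle zero    G = refl
  sumTo-triangle (suc N) G = begin
    sumTo N (λ j → sumTo (suc j) (λ i → G i j)) + sumTo (suc N) (λ i → G i N)
      ≈⟨ +-cong (sumTo-triangle N G) refl ⟩
    sumTo N (λ i → sumTo (N ∸ i) (row i)) + sumTo (suc N) (λ i → G i N)
      ≈⟨ +-cong (trans (+-cong refl (sumTo-cong-bound (row N) (n∸n≡0 N))) (+-identityʳ _)) refl ⟨
    sumTo (suc N) (λ i → sumTo (N ∸ i) (row i)) + sumTo (suc N) (λ i → G i N)
      ≈⟨ sumTo-distrib-+ (suc N) _ _ ⟨
    sumTo (suc N) (λ i → sumTo (N ∸ i) (row i) + G i N)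
      ≈⟨ sumTo-cong-< (suc N) extendRow ⟩
    sumTo (suc N) (λ i → sumTo (suc N ∸ i) (row i)) ∎
    where
    row : ℕ → ℕ → Carrier
    row i l = G i (i ℕ.+ l)

    extendRow : ∀ i → i < suc N → sumTo (N ∸ i) (row i) + G i N ≈ sumTo (suc N ∸ i) (row i)
    extendRow i (s≤s i≤N) = begin
      sumTo (N ∸ i) (row i) + G i N         ≈⟨ +-cong refl (reflexive (P.cong (G i) (m+[n∸m]≡n i≤N))) ⟨
      sumTo (suc (N ∸ i)) (row i)           ≈⟨ sumTo-cong-bound (row i) (+-∸-assoc 1 i≤N) ⟨
      sumTo (suc N ∸ i) (row i)             ∎

  mulS-cong : ∀ {f f′ g g′ : Series} → (∀ n → f n ≈ f′ n) → (∀ n → g n ≈ g′ n) →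
              ∀ n → mulS f g n ≈ mulS f′ g′ n
  mulS-cong f≈f′ g≈g′ n = sumTo-cong (suc n) (λ i → *-cong (f≈f′ i) (g≈g′ (n ∸ i)))

  mulS-comm : ∀ (f g : Series) n → mulS f g n ≈ mulS g f n
  mulS-comm f g n = begin
    sumTo (suc n) (λ i → f i * g (n ∸ i))                ≈⟨ sumTo-reverse n _ ⟩
    sumTo (suc n) (λ i → f (n ∸ i) * g (n ∸ (n ∸ i)))    ≈⟨ sumTo-cong-< (suc n) swap ⟩
    sumTo (suc n) (λ i → g i * f (n ∸ i))                ∎
    where
    swap : ∀ i → i < suc n → f (n ∸ i) * g (n ∸ (n ∸ i)) ≈ g i * f (n ∸ i)
    swap i i<1+n = trans (*-comm _ _) (*-cong (reflexive (P.cong g (m∸[m∸n]≡n (≤-pred i<1+n)))) refl)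

  mulS-assoc : ∀ (f g h : Series) n → mulS (mulS f g) h n ≈ mulS f (mulS g h) n
  mulS-assoc f g h n = begin
    sumTo (suc n) (λ j → sumTo (suc j) (λ i → f i * g (j ∸ i)) * h (n ∸ j))
      ≈⟨ sumTo-cong (suc n) (λ j → *-distribʳ-sumTo (suc j) _ _) ⟩
    sumTo (suc n) (λ j → sumTo (suc j) (λ i → term i j))
      ≈⟨ sumTo-triangle (suc n) term ⟩
    sumTo (suc n) (λ i → sumTo (suc n ∸ i) (λ l → term i (i ℕ.+ l)))
      ≈⟨ sumTo-cong-< (suc n) factorRow ⟩
    sumTo (suc n) (λ i → f i * sumTo (suc (n ∸ i)) (λ l → g l * h (n ∸ i ∸ l))) ∎
    where
    term : ℕ → ℕ → Carrier
    term i j = f i * g (j ∸ i) * h (n ∸ j)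

    factorRow : ∀ i → i < suc n → sumTo (suc n ∸ i) (λ l → term i (i ℕ.+ l))
                                  ≈ f i * sumTo (suc (n ∸ i)) (λ l → g l * h (n ∸ i ∸ l))
    factorRow i (s≤s i≤n) = begin
      sumTo (suc n ∸ i) (λ l → term i (i ℕ.+ l))
        ≈⟨ sumTo-cong-bound _ (+-∸-assoc 1 i≤n) ⟩
      sumTo (suc (n ∸ i)) (λ l → term i (i ℕ.+ l))
        ≈⟨ sumTo-cong (suc (n ∸ i)) (λ l → trans (*-assoc _ _ _)
             (*-cong refl (*-cong (reflexive (P.cong g (m+n∸m≡n i l)))
                                  (reflexive (P.cong h (P.sym (∸-+-assoc n i l))))))) ⟩
      sumTo (suc (n ∸ i)) (λ l → f i * (g l * h (n ∸ i ∸ l)))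
        ≈⟨ *-distribˡ-sumTo (suc (n ∸ i)) _ _ ⟨
      f i * sumTo (suc (n ∸ i)) (λ l → g l * h (n ∸ i ∸ l)) ∎

  mulS-identityʳ : ∀ (f : Series) n → mulS f δ n ≈ f n
  mulS-identityʳ f n = begin
    sumTo n (λ i → f i * δ (n ∸ i)) + f n * δ (n ∸ n)
      ≈⟨ +-cong (sumTo-cong-< n offDiagonal) (*-cong refl (reflexive (P.cong δ (n∸n≡0 n)))) ⟩
    sumTo n (λ _ → 0#) + f n * 1#     ≈⟨ +-cong (sumTo-zero n) (*-identityʳ _) ⟩
    0# + f n                          ≈⟨ +-identityˡ _ ⟩
    f n                               ∎
    where
    offDiagonal : ∀ i → i < n → f i * δ (n ∸ i) ≈ 0#
    offDiagonal i (s≤s i≤m) = trans (*-cong refl (reflexive (P.cong δ (+-∸-assoc 1 i≤m)))) (zeroʳ _)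

  mulS-distribˡ-+ : ∀ (f g h : Series) n → mulS f (λ m → g m + h m) n ≈ mulS f g n + mulS f h n
  mulS-distribˡ-+ f g h n = trans (sumTo-cong (suc n) (λ i → distribˡ _ _ _)) (sumTo-distrib-+ (suc n) _ _)

  powS-cong : ∀ {f g : Series} → (∀ n → f n ≈ g n) → ∀ m n → powS f m n ≈ powS g m n
  powS-cong f≈g zero    n = refl
  powS-cong f≈g (suc m) n = mulS-cong f≈g (powS-cong f≈g m) n

  pow≡^ : ∀ x n → pow x n ≡ x ^ n
  pow≡^ x zero    = P.refl
  pow≡^ x (suc n) = P.cong (x *_) (pow≡^ x n)

  pow-cong : ∀ {x y} n → x ≈ y → pow x n ≈ pow y n
  pow-cong {x} {y} n x≈y rewrite pow≡^ x n | pow≡^ y n = ^-congˡ n x≈y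

  pow-homo-+ : ∀ x m n → pow x (m ℕ.+ n) ≈ pow x m * pow x n
  pow-homo-+ x m n rewrite pow≡^ x (m ℕ.+ n) | pow≡^ x m | pow≡^ x n = ^-homo-* x m n

  pow-distrib-* : ∀ x y n → pow (x * y) n ≈ pow x n * pow y n
  pow-distrib-* x y n rewrite pow≡^ (x * y) n | pow≡^ x n | pow≡^ y n = ^-distrib-* x y n

  pow-neg : ∀ x n → pow (- x) n ≈ pow (- 1#) n * pow x n
  pow-neg x n = trans (pow-cong n (sym (-1*x≈-x x))) (pow-distrib-* (- 1#) x n)

  neg1-square : - 1# * - 1# ≈ 1#
  neg1-square = trans (-1*x≈-x (- 1#)) (⁻¹-involutive 1#)

  pow-neg1-square : ∀ n → pow (- 1#) n * pow (- 1#) n ≈ 1#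
  pow-neg1-square zero    = *-identityˡ 1#
  pow-neg1-square (suc n) = begin
    (- 1# * pow (- 1#) n) * (- 1# * pow (- 1#) n)   ≈⟨ *-interchange _ _ _ _ ⟩
    (- 1# * - 1#) * (pow (- 1#) n * pow (- 1#) n)   ≈⟨ *-cong neg1-square (pow-neg1-square n) ⟩
    1# * 1#                                         ≈⟨ *-identityˡ 1# ⟩
    1#                                              ∎

  powS-scale : ∀ (a x : Carrier) (g : Series) m n →
    powS (λ j → a * (pow x j * g j)) m n ≈ pow a m * (pow x n * powS g m n)
  powS-scale a x g zero zero    = sym (trans (*-identityˡ _) (*-identityˡ _))
  powS-scale a x g zero (suc n) = sym (trans (*-identityˡ _) (zeroʳ _))
  powS-scale a x g (suc m) n = begin
    sumTo (suc n) (λ i → a * (pow x i * g i) * powS (λ j → a * (pow x j * g j)) m (n ∸ i))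
      ≈⟨ sumTo-cong-< (suc n) scaleTerm ⟩
    sumTo (suc n) (λ i → (pow a (suc m) * pow x n) * (g i * powS g m (n ∸ i)))
      ≈⟨ *-distribˡ-sumTo (suc n) _ _ ⟨
    (pow a (suc m) * pow x n) * mulS g (powS g m) n
      ≈⟨ *-assoc _ _ _ ⟩
    pow a (suc m) * (pow x n * mulS g (powS g m) n) ∎
    where
    regroup : ∀ a b c d e f → a * (b * c) * (d * (e * f)) ≈ (a * d * (b * e)) * (c * f)
    regroup = solve 6 (λ a b c d e f → (a ⊕ (b ⊕ c)) ⊕ (d ⊕ (e ⊕ f)) ⊜ ((a ⊕ d) ⊕ (b ⊕ e)) ⊕ (c ⊕ f)) refl

    scaleTerm : ∀ i → i < suc n → a * (pow x i * g i) * powS (λ j → a * (pow x j * g j)) m (n ∸ i)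
                                  ≈ (pow a (suc m) * pow x n) * (g i * powS g m (n ∸ i))
    scaleTerm i (s≤s i≤n) = begin
      a * (pow x i * g i) * powS (λ j → a * (pow x j * g j)) m (n ∸ i)
        ≈⟨ *-cong refl (powS-scale a x g m (n ∸ i)) ⟩
      a * (pow x i * g i) * (pow a m * (pow x (n ∸ i) * powS g m (n ∸ i)))
        ≈⟨ regroup a (pow x i) (g i) (pow a m) (pow x (n ∸ i)) (powS g m (n ∸ i)) ⟩
      (a * pow a m * (pow x i * pow x (n ∸ i))) * (g i * powS g m (n ∸ i))
        ≈⟨ *-cong (*-cong refl (trans (sym (pow-homo-+ x i (n ∸ i))) (reflexive (P.cong (pow x) (m+[n∸m]≡n i≤n))))) refl ⟩
      (pow a (suc m) * pow x n) * (g i * powS g m (n ∸ i)) ∎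

  ι≡×1 : ∀ n → ι n ≡ n × 1#
  ι≡×1 zero    = P.refl
  ι≡×1 (suc n) = P.cong (1# +_) (ι≡×1 n)

  ι-homo-* : ∀ m n → ι (m ℕ.* n) ≈ ι m * ι n
  ι-homo-* m n rewrite ι≡×1 (m ℕ.* n) | ι≡×1 m | ι≡×1 n = ×1-homo-* m n

  1≉0 : ¬ (1# ≈ 0#)
  1≉0 1≈0 = char0 0 (trans (+-identityʳ 1#) 1≈0)

  *-nonzero : ∀ {x y} → ¬ (x ≈ 0#) → ¬ (y ≈ 0#) → ¬ (x * y ≈ 0#)
  *-nonzero {x} {y} x≉0 y≉0 xy≈0 = y≉0 (begin
    y                ≈⟨ *-identityˡ y ⟨
    1# * y           ≈⟨ *-cong (trans (*-comm _ _) (inverseʳ x x≉0)) refl ⟨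
    (x ⁻¹ * x) * y   ≈⟨ *-assoc _ _ _ ⟩
    x ⁻¹ * (x * y)   ≈⟨ *-cong refl xy≈0 ⟩
    x ⁻¹ * 0#        ≈⟨ zeroʳ _ ⟩
    0#               ∎)

  inverse-unique : ∀ {x y} → ¬ (x ≈ 0#) → x * y ≈ 1# → y ≈ x ⁻¹
  inverse-unique {x} {y} x≉0 xy≈1 = begin
    y                ≈⟨ *-identityʳ y ⟨
    y * 1#           ≈⟨ *-cong refl (inverseʳ x x≉0) ⟨
    y * (x * x ⁻¹)   ≈⟨ *-assoc _ _ _ ⟨
    (y * x) * x ⁻¹   ≈⟨ *-cong (trans (*-comm _ _) xy≈1) refl ⟩
    1# * x ⁻¹        ≈⟨ *-identityˡ _ ⟩
    x ⁻¹             ∎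

  ⁻¹-distrib-* : ∀ {x y} → ¬ (x ≈ 0#) → ¬ (y ≈ 0#) → (x * y) ⁻¹ ≈ x ⁻¹ * y ⁻¹
  ⁻¹-distrib-* {x} {y} x≉0 y≉0 = sym (inverse-unique (*-nonzero x≉0 y≉0)
    (trans (*-interchange _ _ _ _) (trans (*-cong (inverseʳ x x≉0) (inverseʳ y y≉0)) (*-identityˡ _))))

  1⁻¹≈1 : 1# ⁻¹ ≈ 1#
  1⁻¹≈1 = sym (inverse-unique 1≉0 (*-identityʳ 1#))

  *-cancelʳ-⁻¹ : ∀ {x} → ¬ (x ≈ 0#) → ∀ a → a * x * x ⁻¹ ≈ a
  *-cancelʳ-⁻¹ {x} x≉0 a = trans (*-assoc _ _ _) (trans (*-cong refl (inverseʳ x x≉0)) (*-identityʳ a))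

  pow-nonzero : ∀ {x} → ¬ (x ≈ 0#) → ∀ n → ¬ (pow x n ≈ 0#)
  pow-nonzero x≉0 zero    = 1≉0
  pow-nonzero x≉0 (suc n) = *-nonzero x≉0 (pow-nonzero x≉0 n)

  ι[n!]≉0 : ∀ n → ¬ (ι (n !) ≈ 0#)
  ι[n!]≉0 zero    = char0 0
  ι[n!]≉0 (suc n) eq = *-nonzero (char0 n) (ι[n!]≉0 n) (trans (sym (ι-homo-* (suc n) (n !))) eq)

  -- `invS f n` is the diagonal entry of a table private to Defs. Row m of that
  -- table is reachable only by unfolding `invS f (suc m)`; it agrees with the
  -- diagonal because each row extends the previous one.
  private
    invS-unfold : ∀ (f : Series) m →
      Σ[ row ∈ Series ] invS f (suc m) ≡ - (f 0 ⁻¹ * sumTo (suc m) (λ i → f (suc i) * row i))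
    invS-unfold f m with suc m ℕ.≤? m
    ... | yes m<m = ⊥-elim (n≮n m m<m)
    ... | no  _   = _ , P.refl

    row : Series → ℕ → Series
    row f m = proj₁ (invS-unfold f m)

    row-zero : ∀ f m → row f m 0 ≡ invS f m
    row-zero f m with suc m ℕ.≤? m
    ... | yes m<m = ⊥-elim (n≮n m m<m)
    ... | no  _   = P.refl

    row-suc : ∀ f m i → i ≤ m → row f (suc m) (suc i) ≡ row f m i
    row-suc f m i i≤m with suc (suc m) ℕ.≤? suc m
    ... | yes m<m = ⊥-elim (n≮n (suc m) m<m)
    ... | no  _ with suc m ℕ.≤? m
    ...   | yes m<m = ⊥-elim (n≮n m m<m)
    ...   | no  _ with m ∸ i ℕ.≤? m
    ...     | yes _      = P.refl
    ...     | no  m∸i≰m = ⊥-elim (m∸i≰m (m∸n≤m m i))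

    row≈invS : ∀ f m i → i ≤ m → row f m i ≈ invS f (m ∸ i)
    row≈invS f m       zero    _         = reflexive (row-zero f m)
    row≈invS f (suc m) (suc i) (s≤s i≤m) = trans (reflexive (row-suc f m i i≤m)) (row≈invS f m i i≤m)

  invS-suc : ∀ (f : Series) m →
    invS f (suc m) ≈ - (f 0 ⁻¹ * sumTo (suc m) (λ i → f (suc i) * invS f (m ∸ i)))
  invS-suc f m = trans (reflexive (proj₂ (invS-unfold f m)))
    (-‿cong (*-cong refl (sumTo-cong-< (suc m) (λ { i (s≤s i≤m) → *-cong refl (row≈invS f m i i≤m) }))))

  mulS-inverseʳ : ∀ (f : Series) → ¬ (f 0 ≈ 0#) → ∀ n → mulS f (invS f) n ≈ δ n
  mulS-inverseʳ f f₀≉0 zero    = trans (+-identityˡ _) (inverseʳ (f 0) f₀≉0)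
  mulS-inverseʳ f f₀≉0 (suc m) = begin
    mulS f (invS f) (suc m)                   ≈⟨ sumTo-head (suc m) _ ⟩
    f 0 * invS f (suc m) + tail               ≈⟨ +-cong (*-cong refl (invS-suc f m)) refl ⟩
    f 0 * - (f 0 ⁻¹ * tail) + tail            ≈⟨ +-cong (-‿distribʳ-* _ _) refl ⟨
    - (f 0 * (f 0 ⁻¹ * tail)) + tail          ≈⟨ +-cong (-‿cong cancel) refl ⟩
    - tail + tail                             ≈⟨ -‿inverseˡ tail ⟩
    0#                                        ∎
    where
    tail : Carrier
    tail = sumTo (suc m) (λ i → f (suc i) * invS f (m ∸ i))

    cancel : f 0 * (f 0 ⁻¹ * tail) ≈ tail
    cancel = trans (sym (*-assoc _ _ _)) (trans (*-cong (inverseʳ (f 0) f₀≉0) refl) (*-identityˡ _))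

  invPow-pred : ∀ m k → invPow (suc m) k ≈ invPow (suc m) (k -ℤ ℤ+ 1) * (ι (suc m)) ⁻¹
  invPow-pred m (ℤ+ zero) = begin
    1# ⁻¹           ≈⟨ 1⁻¹≈1 ⟩
    1#              ≈⟨ *-cancelʳ-⁻¹ (char0 m) 1# ⟨
    1# * y * y ⁻¹   ≈⟨ *-cong (*-comm 1# y) refl ⟩
    y * 1# * y ⁻¹   ∎
    where
    y : Carrier
    y = ι (suc m)
  invPow-pred m (ℤ+ suc j) =
    trans (⁻¹-distrib-* (char0 m) (pow-nonzero (char0 m) j)) (*-comm _ _)
  invPow-pred m -[1+ j ] = begin
    pow y (suc j)                       ≈⟨ *-cancelʳ-⁻¹ (char0 m) _ ⟨
    pow y (suc j) * y * y ⁻¹            ≈⟨ *-cong (*-comm _ _) refl ⟩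
    pow y (suc (suc j)) * y ⁻¹          ≈⟨ reflexive (P.cong (λ j → pow y (suc (suc j)) * y ⁻¹) (P.sym (ℕ.+-identityʳ j))) ⟩
    pow y (suc (suc (j ℕ.+ 0))) * y ⁻¹  ∎
    where
    y : Carrier
    y = ι (suc m)

  ff-zero : ∀ μ m → ff 0# μ (suc m) ≈ 0#
  ff-zero μ zero    = trans (*-identityˡ _) (trans (+-cong refl (trans (-‿cong (zeroˡ μ)) ε⁻¹≈ε)) (+-identityʳ 0#))
  ff-zero μ (suc m) = trans (*-cong (ff-zero μ m) refl) (zeroˡ _)

  expλ-head : ∀ x → expλ x 0 ≈ 1#
  expλ-head x = trans (*-identityˡ _) (trans (⁻¹-cong (+-identityʳ 1#)) 1⁻¹≈1)

  expλ-zero : ∀ n → expλ 0# n ≈ δ n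
  expλ-zero zero    = expλ-head 0#
  expλ-zero (suc n) = trans (*-cong (ff-zero lam n) refl) (zeroˡ _)

  eλ+1-head≉0 : ¬ (eλ 0 + δ 0 ≈ 0#)
  eλ+1-head≉0 eq = char0 1 (trans (+-cong (sym (expλ-head 1#)) (+-identityʳ 1#)) eq)

  eλ-1 : Series
  eλ-1 m = eλ m - δ m

  oneMinusEλm2-scale : ∀ j → oneMinusEλm2 j ≈ - 1# * (pow (- ι 2) j * eλ-1 j)
  oneMinusEλm2-scale j = sym (begin
    - 1# * (p * (eλ j - δ j))   ≈⟨ -1*x≈-x _ ⟩
    - (p * (eλ j - δ j))        ≈⟨ -‿cong (x[y-z]≈xy-xz p (eλ j) (δ j)) ⟩
    - (p * eλ j - p * δ j)      ≈⟨ ⁻¹-anti-homo‿- (p * eλ j) (p * δ j) ⟩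
    p * δ j - p * eλ j          ≈⟨ +-cong (trans (*-comm p (δ j)) (δ-absorbs j)) (-‿cong (*-comm p (eλ j))) ⟩
    δ j - eλ j * p              ∎)
    where
    p : Carrier
    p = pow (- ι 2) j

    δ-absorbs : ∀ j → δ j * pow (- ι 2) j ≈ δ j
    δ-absorbs zero    = *-identityˡ _
    δ-absorbs (suc j) = zeroˡ _

  module _ (k : ℤ) where

    polylogOverT : Series
    polylogOverT = shift (compS (polylogCoef k) oneMinusEλm2)

    eulerGF-1+0 : ∀ n → eulerGF k 1# n + eulerGF k 0# n ≈ polylogOverT n
    eulerGF-1+0 n = begin
      mulS q eλ n + mulS q (expλ 0#) n    ≈⟨ mulS-distribˡ-+ q eλ (expλ 0#) n ⟨
      mulS q (λ m → eλ m + expλ 0# m) n   ≈⟨ mulS-cong (λ _ → refl) (λ m → +-cong (refl {eλ m}) (expλ-zero m)) n ⟩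
      mulS q eλ+1 n                       ≈⟨ mulS-assoc polylogOverT (invS eλ+1) eλ+1 n ⟩
      mulS polylogOverT (mulS (invS eλ+1) eλ+1) n
        ≈⟨ mulS-cong (λ _ → refl) (λ m → trans (mulS-comm (invS eλ+1) eλ+1 m) (mulS-inverseʳ eλ+1 eλ+1-head≉0 m)) n ⟩
      mulS polylogOverT δ n               ≈⟨ mulS-identityʳ polylogOverT n ⟩
      polylogOverT n                      ∎
      where
      eλ+1 : Series
      eλ+1 m = eλ m + δ m

      q : Series
      q = mulS polylogOverT (invS eλ+1)

    polylogOverT-expand : ∀ n → polylogOverT n ≈ sumTo (suc n) (λ i → polylogCoef k (suc i) *
      (pow (- 1#) (suc i) * (pow (- ι 2) (suc n) * powS eλ-1 (suc i) (suc n))))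
    polylogOverT-expand n = begin
      polylogOverT n
        ≈⟨ sumTo-head (suc n) _ ⟩
      polylogCoef k 0 * powS oneMinusEλm2 0 (suc n) + sumTo (suc n) (λ i → polylogCoef k (suc i) * powS oneMinusEλm2 (suc i) (suc n))
        ≈⟨ +-cong (zeroˡ _) (sumTo-cong (suc n) (λ i → *-cong refl (rescale (suc i)))) ⟩
      0# + sumTo (suc n) (λ i → polylogCoef k (suc i) * (pow (- 1#) (suc i) * (pow (- ι 2) (suc n) * powS eλ-1 (suc i) (suc n))))
        ≈⟨ +-identityˡ _ ⟩
      sumTo (suc n) (λ i → polylogCoef k (suc i) * (pow (- 1#) (suc i) * (pow (- ι 2) (suc n) * powS eλ-1 (suc i) (suc n)))) ∎
      where
      rescale : ∀ l → powS oneMinusEλm2 l (suc n) ≈ pow (- 1#) l * (pow (- ι 2) (suc n) * powS eλ-1 l (suc n))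
      rescale l = trans (powS-cong oneMinusEλm2-scale l (suc n)) (powS-scale (- 1#) (- ι 2) _ l (suc n))

    summand : ∀ n i →
      ι (n !) * (polylogCoef k (suc i) * (pow (- 1#) (suc i) * (pow (- ι 2) (suc n) * powS eλ-1 (suc i) (suc n))))
        ≈ pow (ι 2) (suc n) * (ι (suc n)) ⁻¹ *
          (ff 1# (lam ⁻¹) (suc i) * pow (- 1#) n * pow lam i * invPow (suc i) (k -ℤ ℤ+ 1) * S2 (suc n) (suc i))
    summand n i = trans lhs≈common (sym rhs≈common)
      where
      s P Fi J T N M : Carrier
      s = - 1#
      P = powS eλ-1 (suc i) (suc n)
      Fi = ff 1# (lam ⁻¹) (suc i)
      J = invPow (suc i) (k -ℤ ℤ+ 1)
      T = pow (ι 2) (suc n)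
      N = ι (suc n)
      M = ι (suc i)

      common : Carrier
      common = ι (n !) * (Fi * (pow lam i * ((ι (i !)) ⁻¹ * (J * (M ⁻¹ * (pow s n * (T * P)))))))

      lhs≈common : ι (n !) * (polylogCoef k (suc i) * (pow s (suc i) * (pow (- ι 2) (suc n) * P))) ≈ common
      lhs≈common = begin
        ι (n !) * (polylogCoef k (suc i) * (pow s (suc i) * (pow (- ι 2) (suc n) * P)))
          ≈⟨ *-cong refl (*-cong (*-cong (*-cong (*-cong (pow-neg lam i) refl) refl) (invPow-pred i k))
                                 (*-cong refl (*-cong (pow-neg (ι 2) (suc n)) refl))) ⟩
        ι (n !) * ((pow s i * pow lam i * Fi * (ι (i !)) ⁻¹ * (J * M ⁻¹)) * ((s * pow s i) * (((s * pow s n) * T) * P)))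
          ≈⟨ solve 11 (λ a si l f ii j m s sn t p →
               a ⊕ (((((si ⊕ l) ⊕ f) ⊕ ii) ⊕ (j ⊕ m)) ⊕ ((s ⊕ si) ⊕ (((s ⊕ sn) ⊕ t) ⊕ p)))
               ⊜ ((si ⊕ si) ⊕ (s ⊕ s)) ⊕ (a ⊕ (f ⊕ (l ⊕ (ii ⊕ (j ⊕ (m ⊕ (sn ⊕ (t ⊕ p))))))))) refl
               (ι (n !)) (pow s i) (pow lam i) Fi ((ι (i !)) ⁻¹) J (M ⁻¹) s (pow s n) T P ⟩
        (pow s i * pow s i * (s * s)) * common
          ≈⟨ *-cong (trans (*-cong (pow-neg1-square i) neg1-square) (*-identityˡ 1#)) refl ⟩
        1# * common
          ≈⟨ *-identityˡ common ⟩
        common ∎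

      rhs≈common : T * N ⁻¹ * (Fi * pow s n * pow lam i * J * S2 (suc n) (suc i)) ≈ common
      rhs≈common = begin
        T * N ⁻¹ * (Fi * pow s n * pow lam i * J * S2 (suc n) (suc i))
          ≈⟨ *-cong refl (*-cong refl (*-cong (*-cong (ι-homo-* (suc n) (n !))
               (trans (⁻¹-cong (ι-homo-* (suc i) (i !))) (⁻¹-distrib-* (char0 i) (ι[n!]≉0 i)))) refl)) ⟩
        T * N ⁻¹ * (Fi * pow s n * pow lam i * J * (N * ι (n !) * (M ⁻¹ * (ι (i !)) ⁻¹) * P))
          ≈⟨ solve 11 (λ t n′ f sn l j n a m ii p →
               (t ⊕ n′) ⊕ ((((f ⊕ sn) ⊕ l) ⊕ j) ⊕ (((n ⊕ a) ⊕ (m ⊕ ii)) ⊕ p))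
               ⊜ (n ⊕ n′) ⊕ (a ⊕ (f ⊕ (l ⊕ (ii ⊕ (j ⊕ (m ⊕ (sn ⊕ (t ⊕ p))))))))) refl
               T (N ⁻¹) Fi (pow s n) (pow lam i) J N (ι (n !)) (M ⁻¹) ((ι (i !)) ⁻¹) P ⟩
        (N * N ⁻¹) * common
          ≈⟨ *-cong (inverseʳ N (char0 n)) refl ⟩
        1# * common
          ≈⟨ *-identityˡ common ⟩
        common ∎

    E-1+E-0 : ∀ n → E n k 1# + E n k 0# ≈ pow (ι 2) (suc n) * (ι (suc n)) ⁻¹ *
      sumTo (suc n) (λ i → ff 1# (lam ⁻¹) (suc i) * pow (- 1#) n * pow lam i
                           * invPow (suc i) (k -ℤ ℤ+ 1) * S2 (suc n) (suc i))
    E-1+E-0 n = begin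
      ι (n !) * eulerGF k 1# n + ι (n !) * eulerGF k 0# n   ≈⟨ distribˡ _ _ _ ⟨
      ι (n !) * (eulerGF k 1# n + eulerGF k 0# n)           ≈⟨ *-cong refl (eulerGF-1+0 n) ⟩
      ι (n !) * polylogOverT n                              ≈⟨ *-cong refl (polylogOverT-expand n) ⟩
      ι (n !) * sumTo (suc n) _                             ≈⟨ *-distribˡ-sumTo (suc n) _ _ ⟩
      sumTo (suc n) _                                       ≈⟨ sumTo-cong (suc n) (summand n) ⟩
      sumTo (suc n) _                                       ≈⟨ *-distribˡ-sumTo (suc n) _ _ ⟨
      _                                                     ∎

mainTheorem11 : ∀ {c ℓ : Level} (F : Char0Field c ℓ) (lam : Char0Field.Carrier F) →
    let open Char0Field F
        open Degenerate F lam
    in ¬ (lam ≈ 0#) → ∀ (n : ℕ) → 1 ≤ n → ∀ (k : ℤ) →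
      E (n ∸ 1) k 1# + E (n ∸ 1) k 0#
        ≈ pow (ι 2) n * (ι n) ⁻¹ *
          sumTo n (λ i → ff 1# (lam ⁻¹) (suc i) * pow (- 1#) (n ∸ 1)
                         * pow lam i * invPow (suc i) (k -ℤ ℤ+ 1) * S2 n (suc i))
mainTheorem11 F lam _ (suc n) (s≤s _) k = E-1+E-0 F lam k n
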